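{- The $\pi$-calculus with the match operator is not strongly replacement free: there exist a context $C$, an invisible process $I$ and a process $P$ of this calculus such that $C[I]\Downarrow$ but not $C[P]\Downarrow$.
   Context: The $\pi$-calculus with match is the $\pi$-calculus (standard labelled transition semantics; input and output actions visible, $\tau$ invisible) extended with the operator $[x=y]P$, which behaves as $P$ if the names $x$ and $y$ coincide and is stuck otherwise. A context is a term with one hole; $C[P]$ is hole filling. $\Rightarrow$ is the reflexive-transitive closure of $\xrightarrow{\tau}$; $P\Downarrow$ iff $P\Rightarrow\xrightarrow{\alpha}\Rightarrow P'$ for some visible $\alpha$ and $P'$; $P$ is invisible iff not $P\Downarrow$. -}

module Defs where

-- π-calculus with match, de Bruijn presentation.
-- Names are natural numbers (de Bruijn indices; indices beyond the
-- enclosing binders denote free names, of which there are infinitely many).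

open import Data.Nat using (ℕ; zero; suc)
open import Data.Product using (∃; ∃-syntax; _×_; _,_)
open import Relation.Nullary using (¬_)
open import Data.Empty using (⊥)
open import Data.Unit using (⊤)

Name : Set
Name = ℕ

infixr 6 _∣_
infixr 5 _⊕_

data Proc : Set where
  𝟘     : Proc
  τ∙_   : Proc → Proc
  out   : Name → Name → Proc → Proc
  inp   : Name → Proc → Proc            -- x(y).P   (binds index 0 in P)
  _⊕_   : Proc → Proc → Proc
  _∣_   : Proc → Proc → Proc
  ν     : Proc → Proc                   -- (νx)P    (binds index 0 in P)
  !_    : Proc → Proc
  match : Name → Name → Proc → Proc

ext : (Name → Name) → Name → Name
ext ρ zero    = zero
ext ρ (suc i) = suc (ρ i)

ren : (Name → Name) → Proc → Proc
ren ρ 𝟘             = 𝟘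
ren ρ (τ∙ P)        = τ∙ ren ρ P
ren ρ (out x y P)   = out (ρ x) (ρ y) (ren ρ P)
ren ρ (inp x P)     = inp (ρ x) (ren (ext ρ) P)
ren ρ (P ⊕ Q)       = ren ρ P ⊕ ren ρ Q
ren ρ (P ∣ Q)       = ren ρ P ∣ ren ρ Q
ren ρ (ν P)         = ν (ren (ext ρ) P)
ren ρ (! P)         = ! ren ρ P
ren ρ (match x y P) = match (ρ x) (ρ y) (ren ρ P)

shift : Proc → Proc
shift = ren suc

sub0 : Name → Name → Name
sub0 y zero    = y
sub0 y (suc i) = i

swap01 : Name → Name
swap01 zero          = suc zero
swap01 (suc zero)    = zero
swap01 (suc (suc i)) = suc (suc i)

-- actions (early semantics)
data Act : Set where
  τ    : Act
  ain  : Name → Name → Act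
  aout : Name → Name → Act
  bout : Name → Act             -- bound output x̄(z); z is index 0 in the residual

Visible : Act → Set
Visible τ = ⊥
Visible _ = ⊤

-- lift the context of a parallel component past a transition's label
liftBy : Act → Proc → Proc
liftBy (bout x) Q = shift Q
liftBy _        Q = Q

infix 4 _─[_]→_
data _─[_]→_ : Proc → Act → Proc → Set where
  pre-τ   : ∀ {P} → τ∙ P ─[ τ ]→ P
  pre-out : ∀ {x y P} → out x y P ─[ aout x y ]→ P
  pre-inp : ∀ {x y P} → inp x P ─[ ain x y ]→ ren (sub0 y) P
  sumL    : ∀ {P Q a P'} → P ─[ a ]→ P' → P ⊕ Q ─[ a ]→ P'
  sumR    : ∀ {P Q a Q'} → Q ─[ a ]→ Q' → P ⊕ Q ─[ a ]→ Q'
  mat     : ∀ {x P a P'} → P ─[ a ]→ P' → match x x P ─[ a ]→ P'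
  parL    : ∀ {P Q a P'} → P ─[ a ]→ P' → P ∣ Q ─[ a ]→ P' ∣ liftBy a Q
  parR    : ∀ {P Q a Q'} → Q ─[ a ]→ Q' → P ∣ Q ─[ a ]→ liftBy a P ∣ Q'
  commL   : ∀ {P Q x y P' Q'} → P ─[ aout x y ]→ P' → Q ─[ ain x y ]→ Q' →
            P ∣ Q ─[ τ ]→ P' ∣ Q'
  commR   : ∀ {P Q x y P' Q'} → P ─[ ain x y ]→ P' → Q ─[ aout x y ]→ Q' →
            P ∣ Q ─[ τ ]→ P' ∣ Q'
  closeL  : ∀ {P Q x P' Q'} → P ─[ bout x ]→ P' → shift Q ─[ ain (suc x) zero ]→ Q' →
            P ∣ Q ─[ τ ]→ ν (P' ∣ Q')
  closeR  : ∀ {P Q x P' Q'} → shift P ─[ ain (suc x) zero ]→ P' → Q ─[ bout x ]→ Q' →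
            P ∣ Q ─[ τ ]→ ν (P' ∣ Q')
  res-τ   : ∀ {P P'} → P ─[ τ ]→ P' → ν P ─[ τ ]→ ν P'
  res-in  : ∀ {P P' x y} → P ─[ ain (suc x) (suc y) ]→ P' → ν P ─[ ain x y ]→ ν P'
  res-out : ∀ {P P' x y} → P ─[ aout (suc x) (suc y) ]→ P' → ν P ─[ aout x y ]→ ν P'
  res-bo  : ∀ {P P' x} → P ─[ bout (suc x) ]→ P' → ν P ─[ bout x ]→ ν (ren swap01 P')
  open'   : ∀ {P P' x} → P ─[ aout (suc x) zero ]→ P' → ν P ─[ bout x ]→ P'
  rep     : ∀ {P a P'} → P ∣ ! P ─[ a ]→ P' → ! P ─[ a ]→ P'

infix 4 _⇒_
data _⇒_ : Proc → Proc → Set where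
  ε   : ∀ {P} → P ⇒ P
  _◅_ : ∀ {P Q R} → P ─[ τ ]→ Q → Q ⇒ R → P ⇒ R

_⇓ : Proc → Set
P ⇓ = ∃[ P₁ ] ∃[ α ] ∃[ P₂ ] ∃[ P' ] (Visible α × P ⇒ P₁ × P₁ ─[ α ]→ P₂ × P₂ ⇒ P')

Invisible : Proc → Set
Invisible P = ¬ (P ⇓)

data Ctx : Set where
  ●      : Ctx
  τ∙_    : Ctx → Ctx
  out    : Name → Name → Ctx → Ctx
  inp    : Name → Ctx → Ctx
  _⊕ˡ_   : Ctx → Proc → Ctx
  _⊕ʳ_   : Proc → Ctx → Ctx
  _∣ˡ_   : Ctx → Proc → Ctx
  _∣ʳ_   : Proc → Ctx → Ctx
  ν      : Ctx → Ctx
  !_     : Ctx → Ctx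
  match  : Name → Name → Ctx → Ctx

-- hole filling (plain syntactic replacement; names of the filler may be
-- captured by binders of the context, as usual for contexts)
_[_] : Ctx → Proc → Proc
●           [ P ] = P
(τ∙ C)      [ P ] = τ∙ (C [ P ])
out x y C   [ P ] = out x y (C [ P ])
inp x C     [ P ] = inp x (C [ P ])
(C ⊕ˡ Q)    [ P ] = (C [ P ]) ⊕ Q
(Q ⊕ʳ C)    [ P ] = Q ⊕ (C [ P ])
(C ∣ˡ Q)    [ P ] = (C [ P ]) ∣ Q
(Q ∣ʳ C)    [ P ] = Q ∣ (C [ P ])
ν C         [ P ] = ν (C [ P ])
(! C)       [ P ] = ! (C [ P ])
match x y C [ P ] = match x y (C [ P ])

-- Take I = [b=a] z̄z, which is stuck because b and a are distinct names, and the
-- context C = (νa)(āa | a(b).[ ]). Inside C the only move is the private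
-- handshake on a, which instantiates b to a: this turns I into an output on the
-- free name z, while the empty process P = 𝟘 stays silent.
module Submission where

open import Defs
open import Data.Product using (∃-syntax; _×_; _,_)
open import Data.Unit using (tt)
open import Relation.Nullary using (¬_)
open import Relation.Binary.PropositionalEquality using (_≡_; _≢_; refl)

Inert : Proc → Set
Inert P = ∀ {a R} → ¬ (P ─[ a ]→ R)

Inert⇒Invisible : ∀ {P} → Inert P → Invisible P
Inert⇒Invisible inert (_ , _ , _ , _ , _ , ε , t , _)     = inert t
Inert⇒Invisible inert (_ , _ , _ , _ , _ , s ◅ _ , _ , _) = inert s

𝟘-inert : Inert 𝟘
𝟘-inert ()

match-inert : ∀ {x y} → x ≢ y → (P : Proc) → Inert (match x y P)
match-inert x≢y P (mat _) = x≢y refl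

∣-inert : ∀ {P Q} → Inert P → Inert Q → Inert (P ∣ Q)
∣-inert inertP inertQ (parL t)     = inertP t
∣-inert inertP inertQ (parR t)     = inertQ t
∣-inert inertP inertQ (commL t _)  = inertP t
∣-inert inertP inertQ (commR t _)  = inertP t
∣-inert inertP inertQ (closeL t _) = inertP t
∣-inert inertP inertQ (closeR _ t) = inertQ t

ν-inert : ∀ {P} → Inert P → Inert (ν P)
ν-inert inert (res-τ t)   = inert t
ν-inert inert (res-in t)  = inert t
ν-inert inert (res-out t) = inert t
ν-inert inert (res-bo t)  = inert t
ν-inert inert (open' t)   = inert t

Invisible-byτ : ∀ {P} →
  (∀ {a R} → Visible a → ¬ (P ─[ a ]→ R)) →
  (∀ {R} → P ─[ τ ]→ R → Invisible R) →
  Invisible P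
Invisible-byτ noVisible τ-invisible (_ , _ , _ , _ , v , ε , t , r) =
  noVisible v t
Invisible-byτ noVisible τ-invisible (P₁ , α , P₂ , P' , v , s ◅ r₁ , t , r₂) =
  τ-invisible s (P₁ , α , P₂ , P' , v , r₁ , t , r₂)

handshake : Ctx
handshake = ν (out 0 0 𝟘 ∣ʳ inp 0 ●)

-- Both components act on the restricted channel 0, which no rule lets escape.
handshake-noVisible : ∀ {P a R} → Visible a → ¬ (handshake [ P ] ─[ a ]→ R)
handshake-noVisible () (res-τ _)
handshake-noVisible v (res-in (parL ()))
handshake-noVisible v (res-in (parR ()))
handshake-noVisible v (res-out (parL ()))
handshake-noVisible v (res-out (parR ()))
handshake-noVisible v (res-bo (parL ()))
handshake-noVisible v (res-bo (parR ()))
handshake-noVisible v (open' (parL ()))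
handshake-noVisible v (open' (parR ()))

handshake-τ : ∀ {P R} → handshake [ P ] ─[ τ ]→ R → R ≡ ν (𝟘 ∣ ren (sub0 0) P)
handshake-τ (res-τ (parL ()))
handshake-τ (res-τ (parR ()))
handshake-τ (res-τ (commL pre-out pre-inp)) = refl
handshake-τ (res-τ (commR () _))
handshake-τ (res-τ (closeL () _))
handshake-τ (res-τ (closeR () _))

handshake-𝟘-invisible : Invisible (handshake [ 𝟘 ])
handshake-𝟘-invisible = Invisible-byτ handshake-noVisible τ-invisible
  where
  τ-invisible : ∀ {R} → handshake [ 𝟘 ] ─[ τ ]→ R → Invisible R
  τ-invisible t with handshake-τ t
  ... | refl = Inert⇒Invisible (ν-inert (∣-inert 𝟘-inert 𝟘-inert))

-- Under the binders of the handshake, 0 is the received name b, 1 the private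
-- channel a and 2 the free name z.
guardedOutput : Proc
guardedOutput = match 0 1 (out 2 2 𝟘)

guardedOutput-invisible : Invisible guardedOutput
guardedOutput-invisible = Inert⇒Invisible (match-inert (λ ()) (out 2 2 𝟘))

handshake-guardedOutput-⇓ : (handshake [ guardedOutput ]) ⇓
handshake-guardedOutput-⇓ =
  _ , aout 0 0 , _ , _ , tt ,
  res-τ (commL pre-out pre-inp) ◅ ε ,
  res-out (parR (mat pre-out)) , ε

proposition4p1 : ∃[ C ] ∃[ I ] ∃[ P ] (Invisible I × (C [ I ]) ⇓ × ¬ ((C [ P ]) ⇓))
proposition4p1 =
  handshake , guardedOutput , 𝟘 ,
  guardedOutput-invisible , handshake-guardedOutput-⇓ , handshake-𝟘-invisible
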